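{- Let $\alpha \in [0,1]$ and let $\mathcal{G}_1 = (G_1, S, \mu_1, l_1)$, $\mathcal{G}_2 = (G_2, S, \mu_2, l_2)$ be reconciled gene trees with the same leaf set. Then $d_{PLR}(\mathcal{G}_1, \mathcal{G}_2) \geq d_{PLR}(LR(\mathcal{G}_1), LR(\mathcal{G}_2))$.
   Context: All trees are rooted; $L(T)$ is the leaf set, $L(T(v))$ the leaves descending from $v$, $\mathrm{lca}_T$ lowest common ancestor, $dist_T$ path length in edges. A species tree $S$ is a rooted binary tree. A reconciled gene tree is a tuple $\mathcal{G} = (G, S, \mu, l)$ where $G$ is a rooted tree in which every internal node has at least two children, $\mu : V(G) \to V(S)$, $l : V(G) \to \{dup, spec, extant\}$, such that: (1) leaves map to leaves of $S$ and have label $extant$, internal nodes have label $dup$ or $spec$; (2) $u \preceq_G v$ implies $\mu(u) \preceq_S \mu(v)$; (3) if $l(v) = spec$ then $\mu(v)$ is internal in $S$, $v$ has exactly two children $v_1,v_2$, and with $s_1,s_2$ the children of $\mu(v)$, either $\mu(v_1) \preceq_S s_1, \mu(v_2) \preceq_S s_2$ or $\mu(v_2) \preceq_S s_1, \mu(v_1) \preceq_S s_2$. $\mathcal{G}_1,\mathcal{G}_2$ are comparable if they use the same $S$, $L(G_1)=L(G_2)$ and $\mu_1(x)=\mu_2(x)$ for every leaf $x$. For $v \in V(G_1)$, $m(v) = \mathrm{lca}_{G_2}(L(G_1(v)))$; $d_{path}(\mathcal{G}_1,\mathcal{G}_2) = \sum_{v \in V(G_1)} dist_S(\mu_1(v),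 \mu_2(m(v)))$; $d_{lbl}(\mathcal{G}_1,\mathcal{G}_2) = |\{v \in V(G_1): l_1(v) \neq l_2(m(v))\}|$; $d_{asym} = \alpha d_{path} + (1-\alpha) d_{lbl}$; $d_{PLR}(\mathcal{G}_1,\mathcal{G}_2) = d_{asym}(\mathcal{G}_1,\mathcal{G}_2) + d_{asym}(\mathcal{G}_2,\mathcal{G}_1)$ if comparable, and $\infty$ otherwise. An edge $uv$ with $u$ the parent of $v$ is redundant if $\mu(u) = \mu(v)$ and $l(u)=l(v)=dup$. Contracting a redundant edge $uv$ of $\mathcal{G}$ gives $\mathcal{G}/uv$: delete $v$ and its incident edges, add an edge from $u$ to each child of $v$, and restrict $\mu,l$. $LR(\mathcal{G})$ (the least duplication-resolved subtree of $\mathcal{G}$) is obtained by contracting all redundant edges of $\mathcal{G}$ (in any order; the result is unique).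
   Formalization: The parameter α ranges over the rational numbers in [0,1]. -}

module Defs where

open import Data.Bool.Base using (Bool; true; false; if_then_else_; _∧_; not)
open import Data.Nat.Base using (ℕ; zero; suc; _+_; _≡ᵇ_)
open import Data.List.Base using (List; []; _∷_; _++_; length; map)
open import Data.Bool.ListAction using (all; any)
open import Data.Nat.ListAction using (sum)
open import Data.List.Relation.Unary.All using (All)
open import Data.List.Membership.Propositional using (_∈_)
open import Data.List.Relation.Unary.Unique.Propositional using (Unique)
open import Data.Product using (Σ; _×_; _,_)
open import Data.Sum using (_⊎_)
open import Data.Unit using (⊤)
open import Data.Integer.Base using (+_)
open import Data.Rational.Base using (ℚ; _/_; 0ℚ; 1ℚ) renaming (_+_ to _+ℚ_; _*_ to _*ℚ_; _-_ to _-ℚ_; _≤_ to _≤ℚ_)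
open import Relation.Binary.PropositionalEquality using (_≡_)
import Data.Nat.Base as N

data BTree : Set where
  tip : BTree
  bin : BTree → BTree → BTree

data SPos : BTree → Set where
  here  : ∀ {t} → SPos t
  left  : ∀ {l r} → SPos l → SPos (bin l r)
  right : ∀ {l r} → SPos r → SPos (bin l r)

data _⪯_ : ∀ {t} → SPos t → SPos t → Set where
  ⪯-root  : ∀ {t} {p : SPos t} → p ⪯ here
  ⪯-left  : ∀ {l r} {p q : SPos l} → p ⪯ q → left {l} {r} p ⪯ left q
  ⪯-right : ∀ {l r} {p q : SPos r} → p ⪯ q → right {l} {r} p ⪯ right q

data IsLeafS : ∀ {t} → SPos t → Set where
  leaf-here  : IsLeafS {tip} here
  leaf-left  : ∀ {l r} {p : SPos l} → IsLeafS p → IsLeafS (left {l} {r} p)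
  leaf-right : ∀ {l r} {p : SPos r} → IsLeafS p → IsLeafS (right {l} {r} p)

data Dir : Set where
  L R : Dir

data SChild : ∀ {t} → Dir → SPos t → SPos t → Set where
  child-L     : ∀ {l r} → SChild {bin l r} L here (left here)
  child-R     : ∀ {l r} → SChild {bin l r} R here (right here)
  child-left  : ∀ {l r d} {p q : SPos l} → SChild d p q → SChild d (left {l} {r} p) (left q)
  child-right : ∀ {l r d} {p q : SPos r} → SChild d p q → SChild d (right {l} {r} p) (right q)

depth : ∀ {t} → SPos t → ℕ
depth here      = 0
depth (left p)  = suc (depth p)
depth (right p) = suc (depth p)

distS : ∀ {t} → SPos t → SPos t → ℕ
distS (left p)  (left q)  = distS p q
distS (right p) (right q) = distS p q
distS p         q         = depth p + depth q

eqS : ∀ {t} → SPos t → SPos t → Bool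
eqS here      here      = true
eqS (left p)  (left q)  = eqS p q
eqS (right p) (right q) = eqS p q
eqS _         _         = false

-- Reconciled gene trees over a species tree S.
-- Leaves carry a gene name (ℕ) and their image under μ; internal nodes
-- carry their event label (dup / spec) and their image under μ.

data Event : Set where
  dup spec : Event

data Lbl : Set where
  dupL specL extant : Lbl

data GTree (S : BTree) : Set where
  gleaf : ℕ → SPos S → GTree S
  gnode : Event → SPos S → List (GTree S) → GTree S

module _ {S : BTree} where

  μ : GTree S → SPos S
  μ (gleaf _ s)   = s
  μ (gnode _ s _) = s

  lbl : GTree S → Lbl
  lbl (gleaf _ _)      = extant
  lbl (gnode dup _ _)  = dupL
  lbl (gnode spec _ _) = specL

  -- All vertices of the tree (each vertex represented by the subtree it roots).
  mutual
    subtrees : GTree S → List (GTree S)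
    subtrees (gleaf x s)     = gleaf x s ∷ []
    subtrees (gnode e s cs)  = gnode e s cs ∷ subtreesL cs

    subtreesL : List (GTree S) → List (GTree S)
    subtreesL []       = []
    subtreesL (c ∷ cs) = subtrees c ++ subtreesL cs

  mutual
    leafNames : GTree S → List ℕ
    leafNames (gleaf x _)    = x ∷ []
    leafNames (gnode _ _ cs) = leafNamesL cs

    leafNamesL : List (GTree S) → List ℕ
    leafNamesL []       = []
    leafNamesL (c ∷ cs) = leafNames c ++ leafNamesL cs

  mutual
    leafPairs : GTree S → List (ℕ × SPos S)
    leafPairs (gleaf x s)    = (x , s) ∷ []
    leafPairs (gnode _ _ cs) = leafPairsL cs

    leafPairsL : List (GTree S) → List (ℕ × SPos S)
    leafPairsL []       = []
    leafPairsL (c ∷ cs) = leafPairs c ++ leafPairsL cs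

  -- Conditions (1)-(3) of a reconciled gene tree (plus: ≥ 2 children).
  SpecOK : Event → SPos S → List (GTree S) → Set
  SpecOK dup  s cs = ⊤
  SpecOK spec s cs =
    Σ (GTree S) λ v₁ → Σ (GTree S) λ v₂ → cs ≡ v₁ ∷ v₂ ∷ [] ×
    Σ (SPos S) λ s₁ → Σ (SPos S) λ s₂ → SChild L s s₁ × SChild R s s₂ ×
      ((μ v₁ ⪯ s₁ × μ v₂ ⪯ s₂) ⊎ (μ v₂ ⪯ s₁ × μ v₁ ⪯ s₂))

  data Valid : GTree S → Set where
    vleaf : ∀ {x s} → IsLeafS s → Valid (gleaf x s)
    vnode : ∀ {e s cs} →
            2 N.≤ length cs →
            All Valid cs →
            All (λ c → All (λ u → μ u ⪯ s) (subtrees c)) cs →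
            SpecOK e s cs →
            Valid (gnode e s cs)

  IsReconciled : GTree S → Set
  IsReconciled G = Valid G × Unique (leafNames G)

  SameLeafSet : GTree S → GTree S → Set
  SameLeafSet G₁ G₂ = ∀ x → (x ∈ leafNames G₁ → x ∈ leafNames G₂) × (x ∈ leafNames G₂ → x ∈ leafNames G₁)

  -- Comparability (same S is enforced by the type):
  -- L(G₁) = L(G₂) and μ₁(x) = μ₂(x) for every leaf x.

  memᵇ : ℕ → List ℕ → Bool
  memᵇ x ys = any (λ y → x ≡ᵇ y) ys

  comparableᵇ : GTree S → GTree S → Bool
  comparableᵇ G₁ G₂ =
    all (λ x → memᵇ x (leafNames G₂)) (leafNames G₁) ∧
    all (λ x → memᵇ x (leafNames G₁)) (leafNames G₂) ∧
    all (λ { (x , s₁) → all (λ { (y , s₂) → if x ≡ᵇ y then eqS s₁ s₂ else true }) (leafPairs G₂) })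
        (leafPairs G₁)

  -- lca_T(X): the lowest vertex of T whose subtree contains all of X
  -- (returned as the subtree it roots).

  subᵇ : List ℕ → List ℕ → Bool
  subᵇ xs ys = all (λ x → memᵇ x ys) xs

  mutual
    lcaT : GTree S → List ℕ → GTree S
    lcaT (gleaf x s)    X = gleaf x s
    lcaT (gnode e s cs) X = lcaL (gnode e s cs) cs X

    lcaL : GTree S → List (GTree S) → List ℕ → GTree S
    lcaL d []       X = d
    lcaL d (c ∷ cs) X = if subᵇ X (leafNames c) then lcaT c X else lcaL d cs X

  eqLbl : Lbl → Lbl → Bool
  eqLbl dupL   dupL   = true
  eqLbl specL  specL  = true
  eqLbl extant extant = true
  eqLbl _      _      = false

  m : GTree S → GTree S → GTree S
  m G₂ v = lcaT G₂ (leafNames v)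

  dPath : GTree S → GTree S → ℕ
  dPath G₁ G₂ = sum (map (λ v → distS (μ v) (μ (m G₂ v))) (subtrees G₁))

  dLbl : GTree S → GTree S → ℕ
  dLbl G₁ G₂ = sum (map (λ v → if eqLbl (lbl v) (lbl (m G₂ v)) then 0 else 1) (subtrees G₁))

  toℚ : ℕ → ℚ
  toℚ n = (+ n) / 1

  dAsym : ℚ → GTree S → GTree S → ℚ
  dAsym α G₁ G₂ = (α *ℚ toℚ (dPath G₁ G₂)) +ℚ ((1ℚ -ℚ α) *ℚ toℚ (dLbl G₁ G₂))

data ℚ∞ : Set where
  fin : ℚ → ℚ∞
  ∞   : ℚ∞

data _≤∞_ : ℚ∞ → ℚ∞ → Set where
  fin≤fin : ∀ {a b} → a ≤ℚ b → fin a ≤∞ fin b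
  _≤∞∞    : ∀ x → x ≤∞ ∞

module _ {S : BTree} where

  dPLR : ℚ → GTree S → GTree S → ℚ∞
  dPLR α G₁ G₂ = if comparableᵇ G₁ G₂ then fin (dAsym α G₁ G₂ +ℚ dAsym α G₂ G₁) else ∞

  -- LR(G): contract every redundant edge uv (μ(u)=μ(v), l(u)=l(v)=dup).
  -- Bottom-up: after the children are processed, a dup child of a dup
  -- node with the same μ-image is spliced into its parent; its own
  -- children are (already) not redundant with respect to it, hence
  -- not with respect to the parent either.

  absorb : SPos S → GTree S → List (GTree S)
  absorb s (gnode dup s' ds) = if eqS s s' then ds else gnode dup s' ds ∷ []
  absorb s c                 = c ∷ []

  splice : SPos S → List (GTree S) → List (GTree S)
  splice s []       = []
  splice s (c ∷ cs) = absorb s c ++ splice s cs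

  mutual
    LR : GTree S → GTree S
    LR (gleaf x s)       = gleaf x s
    LR (gnode dup s cs)  = gnode dup s (splice s (LRL cs))
    LR (gnode spec s cs) = gnode spec s (LRL cs)

    LRL : List (GTree S) → List (GTree S)
    LRL []       = []
    LRL (c ∷ cs) = LR c ∷ LRL cs

-- Contracting a redundant edge deletes one vertex and leaves every other vertex with the
-- same μ-image, label and leaf set. So the leaves, hence comparability, are unchanged, and
-- the sums defining d_path and d_lbl can only lose terms, provided m(v) keeps its μ-image
-- and label, the only data of m(v) that the distances use. If the lca search in G enters a
-- dup child w that LR merges into its dup parent u, then either it continues into a child
-- of w, which LR(G) still reaches from u, or it stops at w, and in LR(G) it stops at u,
-- which has the same μ-image and label. Since leaf names are distinct, no later sibling of
-- w can capture the query instead.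
module Submission where

open import Defs
open import Data.Bool.Base using (true; false; if_then_else_; T; _∧_)
open import Data.Bool.ListAction using (and; all)
open import Data.Empty using (⊥; ⊥-elim)
open import Data.Unit using (⊤; tt)
open import Data.Product using (_×_; _,_; proj₁)
open import Data.Nat.Base using (ℕ; z≤n) renaming (_≤_ to _≤ℕ_)
import Data.Nat.Properties as ℕ
open import Data.Nat.ListAction using (sum)
open import Data.List.Base using (List; []; _∷_; _++_; map)
open import Data.List.Properties using (map-++; map-cong; ++-identityʳ; ++-assoc)
open import Data.List.Relation.Unary.All as All using (All; []; _∷_)
import Data.List.Relation.Unary.All.Properties as All
import Data.List.Relation.Unary.Any as Any
open import Data.List.Relation.Unary.Any.Properties using (any⁺; any⁻)
open import Data.List.Relation.Unary.Unique.Propositional using (Unique; []; _∷_)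
open import Data.List.Membership.Propositional using (_∈_; _∉_)
open import Data.List.Relation.Binary.Subset.Propositional using (_⊆_)
open import Data.List.Relation.Binary.Subset.Propositional.Properties
  using (xs⊆xs++ys; xs⊆ys++xs)
open import Data.List.Relation.Binary.Sublist.Heterogeneous using (Sublist; []; _∷_; _∷ʳ_)
import Data.List.Relation.Binary.Sublist.Heterogeneous.Properties as Sublist
open import Data.Integer.Base using (+_; +≤+)
import Data.Integer.Properties as ℤ
open import Data.Rational.Base using (ℚ; 0ℚ; 1ℚ; _≤_; *≤*; mkℚ; nonNegative; -_)
  renaming (_-_ to _-ℚ_)
import Data.Rational.Properties as ℚ
import Data.Nat.Coprimality as Coprime
open import Function.Base using (_∘_; _on_)
open import Relation.Binary.Core using (Rel)
open import Relation.Binary.PropositionalEquality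
open import Relation.Nullary using (¬_)

NonEmpty : {A : Set} → List A → Set
NonEmpty []      = ⊥
NonEmpty (_ ∷ _) = ⊤

NonEmpty-++ : {A : Set} {xs ys : List A} → NonEmpty xs → NonEmpty (xs ++ ys)
NonEmpty-++ {xs = _ ∷ _} _ = tt

module _ {A : Set} where

  Unique-++⁻ˡ : ∀ (xs : List A) {ys} → Unique (xs ++ ys) → Unique xs
  Unique-++⁻ˡ []       _          = []
  Unique-++⁻ˡ (_ ∷ xs) (x∉ ∷ xs!) = All.++⁻ˡ xs x∉ ∷ Unique-++⁻ˡ xs xs!

  Unique-++⁻ʳ : ∀ (xs : List A) {ys} → Unique (xs ++ ys) → Unique ys
  Unique-++⁻ʳ []       ys!       = ys!
  Unique-++⁻ʳ (_ ∷ xs) (_ ∷ xs!) = Unique-++⁻ʳ xs xs!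

  Unique-++⇒∉ : ∀ (xs : List A) {ys z} → Unique (xs ++ ys) → z ∈ xs → z ∉ ys
  Unique-++⇒∉ (_ ∷ xs) (x∉ ∷ _)  (Any.here refl)  z∈ys = All.lookup (All.++⁻ʳ xs x∉) z∈ys refl
  Unique-++⇒∉ (_ ∷ xs) (_ ∷ xs!) (Any.there z∈xs) z∈ys = Unique-++⇒∉ xs xs! z∈xs z∈ys

  sum-map-mono : ∀ {r} {R : Rel A r} (f : A → ℕ) → (∀ {x y} → R x y → f x ≡ f y) →
                 ∀ {xs ys} → Sublist R xs ys → sum (map f xs) ≤ℕ sum (map f ys)
  sum-map-mono f f-resp []           = z≤n
  sum-map-mono f f-resp (y ∷ʳ xs⊑ys) =
    ℕ.≤-trans (sum-map-mono f f-resp xs⊑ys) (ℕ.m≤n+m _ (f y))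
  sum-map-mono f f-resp (x∼y ∷ xs⊑ys) =
    ℕ.+-mono-≤ (ℕ.≤-reflexive (f-resp x∼y)) (sum-map-mono f f-resp xs⊑ys)

if-fin-mono : ∀ {b b′} {x y : ℚ} → b ≡ b′ → x ≤ y →
              (if b then fin x else ∞) ≤∞ (if b′ then fin y else ∞)
if-fin-mono {true}  refl = fin≤fin
if-fin-mono {false} refl _ = ∞ ≤∞∞

eqS-sound : ∀ {t} (p q : SPos t) → T (eqS p q) → p ≡ q
eqS-sound here      here      _  = refl
eqS-sound (left p)  (left q)  eq = cong left (eqS-sound p q eq)
eqS-sound (right p) (right q) eq = cong right (eqS-sound p q eq)
eqS-sound here      (left _)  ()
eqS-sound here      (right _) ()
eqS-sound (left _)  here      ()
eqS-sound (left _)  (right _) ()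
eqS-sound (right _) here      ()
eqS-sound (right _) (left _)  ()

module _ {S : BTree} where

  memᵇ-sound : ∀ {x ys} → T (memᵇ {S} x ys) → x ∈ ys
  memᵇ-sound {x} {ys} = Any.map (ℕ.≡ᵇ⇒≡ x _) ∘ any⁻ _ ys

  memᵇ-complete : ∀ {x ys} → x ∈ ys → T (memᵇ {S} x ys)
  memᵇ-complete {x} = any⁺ _ ∘ Any.map (ℕ.≡⇒≡ᵇ x _)

  subᵇ-sound : ∀ {X ys} → T (subᵇ {S} X ys) → All (_∈ ys) X
  subᵇ-sound {X} = All.map memᵇ-sound ∘ All.all⁺ _ X

  subᵇ-complete : ∀ {X ys} → All (_∈ ys) X → T (subᵇ {S} X ys)
  subᵇ-complete = All.all⁻ _ ∘ All.map memᵇ-complete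

  subᵇ-mono : ∀ {X ys zs} → ys ⊆ zs → T (subᵇ {S} X ys) → T (subᵇ {S} X zs)
  subᵇ-mono {X} ys⊆zs = subᵇ-complete {X} ∘ All.map ys⊆zs ∘ subᵇ-sound {X}

  μl : GTree S → SPos S × Lbl
  μl t = μ t , lbl t

  _≈_ : GTree S → GTree S → Set
  t ≈ u = μl t ≡ μl u

  leafPairsL-++ : (xs ys : List (GTree S)) →
                  leafPairsL (xs ++ ys) ≡ leafPairsL xs ++ leafPairsL ys
  leafPairsL-++ []       ys = refl
  leafPairsL-++ (x ∷ xs) ys =
    trans (cong (leafPairs x ++_) (leafPairsL-++ xs ys)) (sym (++-assoc (leafPairs x) _ _))

  leafPairs-absorb : (s : SPos S) (t : GTree S) → leafPairsL (absorb s t) ≡ leafPairs t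
  leafPairs-absorb s (gleaf _ _)        = ++-identityʳ _
  leafPairs-absorb s (gnode spec _ _)   = ++-identityʳ _
  leafPairs-absorb s (gnode dup s′ ds) with eqS s s′
  ... | true  = refl
  ... | false = ++-identityʳ _

  leafPairs-splice : (s : SPos S) (ts : List (GTree S)) →
                     leafPairsL (splice s ts) ≡ leafPairsL ts
  leafPairs-splice s []       = refl
  leafPairs-splice s (t ∷ ts) =
    trans (leafPairsL-++ (absorb s t) (splice s ts))
          (cong₂ _++_ (leafPairs-absorb s t) (leafPairs-splice s ts))

  mutual
    leafPairs-LR : (t : GTree S) → leafPairs (LR t) ≡ leafPairs t
    leafPairs-LR (gleaf _ _)       = refl
    leafPairs-LR (gnode dup s cs)  = trans (leafPairs-splice s (LRL cs)) (leafPairsL-LRL cs)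
    leafPairs-LR (gnode spec s cs) = leafPairsL-LRL cs

    leafPairsL-LRL : (cs : List (GTree S)) → leafPairsL (LRL cs) ≡ leafPairsL cs
    leafPairsL-LRL []       = refl
    leafPairsL-LRL (c ∷ cs) = cong₂ _++_ (leafPairs-LR c) (leafPairsL-LRL cs)

  mutual
    leafNames≡proj₁-leafPairs : (t : GTree S) → leafNames t ≡ map proj₁ (leafPairs t)
    leafNames≡proj₁-leafPairs (gleaf _ _)    = refl
    leafNames≡proj₁-leafPairs (gnode _ _ cs) = leafNamesL≡proj₁-leafPairsL cs

    leafNamesL≡proj₁-leafPairsL : (cs : List (GTree S)) →
                                  leafNamesL cs ≡ map proj₁ (leafPairsL cs)
    leafNamesL≡proj₁-leafPairsL []       = refl
    leafNamesL≡proj₁-leafPairsL (c ∷ cs) =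
      trans (cong₂ _++_ (leafNames≡proj₁-leafPairs c) (leafNamesL≡proj₁-leafPairsL cs))
            (sym (map-++ proj₁ (leafPairs c) (leafPairsL cs)))

  leafNames-LR : (t : GTree S) → leafNames (LR t) ≡ leafNames t
  leafNames-LR t = begin
    leafNames (LR t)              ≡⟨ leafNames≡proj₁-leafPairs (LR t) ⟩
    map proj₁ (leafPairs (LR t))  ≡⟨ cong (map proj₁) (leafPairs-LR t) ⟩
    map proj₁ (leafPairs t)       ≡⟨ leafNames≡proj₁-leafPairs t ⟨
    leafNames t                   ∎
    where open ≡-Reasoning

  leafNamesL-LRL : (cs : List (GTree S)) → leafNamesL (LRL cs) ≡ leafNamesL cs
  leafNamesL-LRL []       = refl
  leafNamesL-LRL (c ∷ cs) = cong₂ _++_ (leafNames-LR c) (leafNamesL-LRL cs)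

  comparableᵇ-LR : (G₁ G₂ : GTree S) → comparableᵇ (LR G₁) (LR G₂) ≡ comparableᵇ G₁ G₂
  -- leafPairs G₂ occurs under a pattern lambda of comparableᵇ, out of reach of rewrite.
  comparableᵇ-LR G₁ G₂
    rewrite leafNames-LR G₁ | leafNames-LR G₂ | leafPairs-LR G₁ =
    cong (λ b → subᵇ {S} (leafNames G₁) (leafNames G₂) ∧
                (subᵇ {S} (leafNames G₂) (leafNames G₁) ∧ b))
         (cong and (map-cong (λ _ → cong (all _) (leafPairs-LR G₂)) (leafPairs G₁)))

  profile : GTree S → (SPos S × Lbl) × List ℕ
  profile v = μl v , leafNames v

  _⊑_ : List (GTree S) → List (GTree S) → Set
  _⊑_ = Sublist (_≡_ on profile)

  ⊑-trans : ∀ {xs ys zs} → xs ⊑ ys → ys ⊑ zs → xs ⊑ zs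
  ⊑-trans = Sublist.trans trans

  subtreesL-++ : (xs ys : List (GTree S)) →
                 subtreesL (xs ++ ys) ≡ subtreesL xs ++ subtreesL ys
  subtreesL-++ []       ys = refl
  subtreesL-++ (x ∷ xs) ys =
    trans (cong (subtrees x ++_) (subtreesL-++ xs ys)) (sym (++-assoc (subtrees x) _ _))

  subtreesL-absorb-⊑ : (s : SPos S) (t : GTree S) → subtreesL (absorb s t) ⊑ subtrees t
  subtreesL-absorb-⊑ s (gleaf x s′)       = Sublist.reflexive refl (++-identityʳ _)
  subtreesL-absorb-⊑ s (gnode spec s′ ds) = Sublist.reflexive refl (++-identityʳ _)
  subtreesL-absorb-⊑ s (gnode dup s′ ds) with eqS s s′
  ... | true  = gnode dup s′ ds ∷ʳ Sublist.refl refl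
  ... | false = Sublist.reflexive refl (++-identityʳ _)

  subtreesL-splice-⊑ : (s : SPos S) (ts : List (GTree S)) →
                       subtreesL (splice s ts) ⊑ subtreesL ts
  subtreesL-splice-⊑ s []       = []
  subtreesL-splice-⊑ s (t ∷ ts) =
    subst (_⊑ subtreesL (t ∷ ts)) (sym (subtreesL-++ (absorb s t) (splice s ts)))
          (Sublist.++⁺ (subtreesL-absorb-⊑ s t) (subtreesL-splice-⊑ s ts))

  mutual
    subtrees-LR-⊑ : (t : GTree S) → subtrees (LR t) ⊑ subtrees t
    subtrees-LR-⊑ (gleaf x s)       = refl ∷ []
    subtrees-LR-⊑ (gnode dup s cs)  =
      cong ((s , dupL) ,_) (leafNames-LR (gnode dup s cs)) ∷
      ⊑-trans (subtreesL-splice-⊑ s (LRL cs)) (subtreesL-LRL-⊑ cs)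
    subtrees-LR-⊑ (gnode spec s cs) =
      cong ((s , specL) ,_) (leafNamesL-LRL cs) ∷ subtreesL-LRL-⊑ cs

    subtreesL-LRL-⊑ : (cs : List (GTree S)) → subtreesL (LRL cs) ⊑ subtreesL cs
    subtreesL-LRL-⊑ []       = []
    subtreesL-LRL-⊑ (c ∷ cs) = Sublist.++⁺ (subtrees-LR-⊑ c) (subtreesL-LRL-⊑ cs)

  lcaL-++ : ∀ (d : GTree S) xs ys X → lcaL d (xs ++ ys) X ≡ lcaL (lcaL d ys X) xs X
  lcaL-++ d []       ys X = refl
  lcaL-++ d (x ∷ xs) ys X with subᵇ {S} X (leafNames x)
  ... | true  = refl
  ... | false = lcaL-++ d xs ys X

  lcaL-resp-≈ : ∀ {D D′} (ds : List (GTree S)) X → D ≈ D′ → lcaL D ds X ≈ lcaL D′ ds X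
  lcaL-resp-≈ []       X D≈D′ = D≈D′
  lcaL-resp-≈ (d ∷ ds) X D≈D′ with subᵇ {S} X (leafNames d)
  ... | true  = refl
  ... | false = lcaL-resp-≈ ds X D≈D′

  lcaL-miss : ∀ (D : GTree S) ds X → ¬ T (subᵇ {S} X (leafNamesL ds)) → lcaL D ds X ≡ D
  lcaL-miss D []       X _    = refl
  lcaL-miss D (d ∷ ds) X miss with subᵇ {S} X (leafNames d) in hit
  ... | true  =
    ⊥-elim (miss (subᵇ-mono {X} (xs⊆xs++ys (leafNames d) (leafNamesL ds)) (subst T (sym hit) tt)))
  ... | false = lcaL-miss D ds X (miss ∘ subᵇ-mono {X} (xs⊆ys++xs (leafNamesL ds) (leafNames d)))

  lcaL-∉ : ∀ (D : GTree S) ds {x} X → x ∉ leafNamesL ds → lcaL D ds (x ∷ X) ≡ D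
  lcaL-∉ D ds {x} X x∉ = lcaL-miss D ds (x ∷ X) (x∉ ∘ All.head ∘ subᵇ-sound {x ∷ X})

  -- Needed only for the empty query, which descends along first children.
  Branching : GTree S → Set
  Branching (gleaf _ _)    = ⊤
  Branching (gnode _ _ ds) = NonEmpty ds

  absorb-nonEmpty : ∀ (s : SPos S) t → Branching t → NonEmpty (absorb s t)
  absorb-nonEmpty s (gleaf _ _)        _ = tt
  absorb-nonEmpty s (gnode spec _ _)   _ = tt
  absorb-nonEmpty s (gnode dup s′ ds) b with eqS s s′
  ... | true  = b
  ... | false = tt

  LR-branching : ∀ {t} → Valid t → Branching (LR t)
  LR-branching (vleaf _)                                   = tt
  LR-branching {gnode _    _ []}      (vnode () _ _ _)
  LR-branching {gnode dup  s (c ∷ _)} (vnode _ (vc ∷ _) _ _) =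
    NonEmpty-++ (absorb-nonEmpty s (LR c) (LR-branching vc))
  LR-branching {gnode spec s (_ ∷ _)} _                    = tt

  LRL-branching : ∀ {cs} → All Valid cs → All Branching (LRL cs)
  LRL-branching []         = []
  LRL-branching (vc ∷ vcs) = LR-branching vc ∷ LRL-branching vcs

  lcaL-absorb-[] : ∀ (s : SPos S) t D → Branching t → lcaL D (absorb s t) [] ≡ lcaT t []
  lcaL-absorb-[] s (gleaf _ _)              D _  = refl
  lcaL-absorb-[] s (gnode spec _ _)         D _  = refl
  lcaL-absorb-[] s (gnode dup s′ [])        D ()
  lcaL-absorb-[] s (gnode dup s′ (_ ∷ _)) D _ with eqS s s′
  ... | true  = refl
  ... | false = refl

  -- The right-hand side is one step of lcaL a (t ∷ ts) (x ∷ X), with R the result on ts.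
  lcaL-absorb : ∀ (s : SPos S) t {D R} x X → D ≈ R → (x ∈ leafNames t → μl R ≡ (s , dupL)) →
                lcaL D (absorb s t) (x ∷ X) ≈ lcaL R (t ∷ []) (x ∷ X)
  lcaL-absorb s t@(gleaf _ _)      x X D≈R _ = lcaL-resp-≈ (t ∷ []) (x ∷ X) D≈R
  lcaL-absorb s t@(gnode spec _ _) x X D≈R _ = lcaL-resp-≈ (t ∷ []) (x ∷ X) D≈R
  lcaL-absorb s t@(gnode dup s′ ds) {D} x X D≈R R-dup with eqS s s′ in s≟s′
  ... | false = lcaL-resp-≈ (t ∷ []) (x ∷ X) D≈R
  ... | true with subᵇ {S} (x ∷ X) (leafNamesL ds) in hit
  ...   | false = trans (cong μl (lcaL-miss D ds (x ∷ X) (subst T hit))) D≈R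
  ...   | true  = lcaL-resp-≈ ds (x ∷ X) (trans D≈R (trans (R-dup x∈t) (cong (_, dupL) s≡s′)))
    where
    x∈t : x ∈ leafNamesL ds
    x∈t = All.head (subᵇ-sound {x ∷ X} (subst T (sym hit) tt))
    s≡s′ : s ≡ s′
    s≡s′ = eqS-sound s s′ (subst T (sym s≟s′) tt)

  lcaL-splice : ∀ {a} (s : SPos S) ts X → μl a ≡ (s , dupL) →
                All Branching ts → Unique (leafNamesL ts) →
                lcaL a (splice s ts) X ≈ lcaL a ts X
  lcaL-splice     s []       X       _     _          _ = refl
  lcaL-splice {a} s (t ∷ ts) []      _     (bt ∷ _)   _ =
    cong μl (trans (lcaL-++ a (absorb s t) (splice s ts) []) (lcaL-absorb-[] s t _ bt))
  lcaL-splice {a} s (t ∷ ts) (x ∷ X) a-dup (_ ∷ bts) u = begin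
    μl (lcaL a (absorb s t ++ splice s ts) (x ∷ X))
      ≡⟨ cong μl (lcaL-++ a (absorb s t) (splice s ts) (x ∷ X)) ⟩
    μl (lcaL (lcaL a (splice s ts) (x ∷ X)) (absorb s t) (x ∷ X))
      ≡⟨ lcaL-absorb s t x X (lcaL-splice s ts (x ∷ X) a-dup bts (Unique-++⁻ʳ (leafNames t) u))
                     R-dup ⟩
    μl (lcaL (lcaL a ts (x ∷ X)) (t ∷ []) (x ∷ X))
      ∎
    where
    open ≡-Reasoning
    R-dup : x ∈ leafNames t → μl (lcaL a ts (x ∷ X)) ≡ (s , dupL)
    R-dup x∈t = trans (cong μl (lcaL-∉ a ts X (Unique-++⇒∉ (leafNames t) u x∈t))) a-dup

  mutual
    lca-LR : ∀ {t} → Valid t → Unique (leafNames t) → ∀ X → lcaT (LR t) X ≈ lcaT t X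
    lca-LR (vleaf _) _ X = refl
    lca-LR {gnode spec s cs} (vnode _ vcs _ _) u X = lcaL-LRL vcs u X refl
    lca-LR {gnode dup  s cs} (vnode _ vcs _ _) u X =
      trans (lcaL-splice s (LRL cs) X refl (LRL-branching vcs)
                         (subst Unique (sym (leafNamesL-LRL cs)) u))
            (lcaL-LRL vcs u X refl)

    lcaL-LRL : ∀ {a g cs} → All Valid cs → Unique (leafNamesL cs) → ∀ X → a ≈ g →
               lcaL a (LRL cs) X ≈ lcaL g cs X
    lcaL-LRL                 []         _ X a≈g = a≈g
    lcaL-LRL {cs = c ∷ cs} (vc ∷ vcs) u X a≈g
      rewrite leafNames-LR c with subᵇ {S} X (leafNames c)
    ... | true  = lca-LR vc (Unique-++⁻ˡ (leafNames c) u) X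
    ... | false = lcaL-LRL vcs (Unique-++⁻ʳ (leafNames c) u) X a≈g

  vertexSum : (SPos S × Lbl → SPos S × Lbl → ℕ) → GTree S → GTree S → ℕ
  vertexSum f G₁ G₂ = sum (map (λ v → f (μl v) (μl (m G₂ v))) (subtrees G₁))

  vertexSum-LR : ∀ f (G₁ G₂ : GTree S) → Valid G₂ → Unique (leafNames G₂) →
                 vertexSum f (LR G₁) (LR G₂) ≤ℕ vertexSum f G₁ G₂
  vertexSum-LR f G₁ G₂ v₂ u₂ = begin
    vertexSum f (LR G₁) (LR G₂)
      ≡⟨ cong sum (map-cong (λ v → cong (f (μl v)) (lca-LR v₂ u₂ (leafNames v)))
                            (subtrees (LR G₁))) ⟩
    sum (map cost (subtrees (LR G₁)))
      ≤⟨ sum-map-mono cost (cong λ { (p , X) → f p (μl (lcaT G₂ X)) }) (subtrees-LR-⊑ G₁) ⟩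
    vertexSum f G₁ G₂
      ∎
    where
    open ℕ.≤-Reasoning
    cost : GTree S → ℕ
    cost v = f (μl v) (μl (m G₂ v))

  dPath-LR : ∀ (G₁ G₂ : GTree S) → Valid G₂ → Unique (leafNames G₂) →
             dPath (LR G₁) (LR G₂) ≤ℕ dPath G₁ G₂
  dPath-LR = vertexSum-LR (λ (p , _) (q , _) → distS p q)

  dLbl-LR : ∀ (G₁ G₂ : GTree S) → Valid G₂ → Unique (leafNames G₂) →
            dLbl (LR G₁) (LR G₂) ≤ℕ dLbl G₁ G₂
  dLbl-LR = vertexSum-LR (λ (_ , k) (_ , l) → if eqLbl {S} k l then 0 else 1)

  toℚ≡mkℚ : ∀ n → toℚ {S} n ≡ mkℚ (+ n) 0 (Coprime.sym (Coprime.1-coprimeTo n))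
  toℚ≡mkℚ n = ℚ.normalize-coprime (Coprime.sym (Coprime.1-coprimeTo n))

  toℚ-mono : ∀ {a b} → a ≤ℕ b → toℚ {S} a ≤ toℚ {S} b
  toℚ-mono {a} {b} a≤b rewrite toℚ≡mkℚ a | toℚ≡mkℚ b =
    *≤* (ℤ.*-monoʳ-≤-nonNeg (+ 1) (+≤+ a≤b))

  dAsym-LR : ∀ {α} → 0ℚ ≤ α → α ≤ 1ℚ →
             ∀ (G₁ G₂ : GTree S) → Valid G₂ → Unique (leafNames G₂) →
             dAsym α (LR G₁) (LR G₂) ≤ dAsym α G₁ G₂
  dAsym-LR {α} 0≤α α≤1 G₁ G₂ v₂ u₂ =
    ℚ.+-mono-≤
      (ℚ.*-monoˡ-≤-nonNeg α {{nonNegative 0≤α}} (toℚ-mono (dPath-LR G₁ G₂ v₂ u₂)))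
      (ℚ.*-monoˡ-≤-nonNeg (1ℚ -ℚ α) {{nonNegative 0≤1-α}} (toℚ-mono (dLbl-LR G₁ G₂ v₂ u₂)))
    where
    0≤1-α : 0ℚ ≤ 1ℚ -ℚ α
    0≤1-α = subst (_≤ 1ℚ -ℚ α) (ℚ.+-inverseʳ α) (ℚ.+-monoˡ-≤ (- α) α≤1)

corollary1 : {S : BTree} (α : ℚ) → 0ℚ ≤ α → α ≤ 1ℚ →
             (G₁ G₂ : GTree S) → IsReconciled G₁ → IsReconciled G₂ →
             SameLeafSet G₁ G₂ →
             dPLR α (LR G₁) (LR G₂) ≤∞ dPLR α G₁ G₂
corollary1 α 0≤α α≤1 G₁ G₂ (v₁ , u₁) (v₂ , u₂) _ =
  if-fin-mono (comparableᵇ-LR G₁ G₂)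
    (ℚ.+-mono-≤ (dAsym-LR 0≤α α≤1 G₁ G₂ v₂ u₂) (dAsym-LR 0≤α α≤1 G₂ G₁ v₁ u₁))
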